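{- Let $H$ be a connected graph with $r$ vertices, $q$ a positive integer, and let $\phi$ be an isomorphism from the auxiliary $r$-uniform hypergraph $\mathcal{H}$ (on $V(H(q))$, whose edges are the vertex sets of the standard copies of $H$ in $H(q)$) to $\mathcal{H}_q^r$; identify $V(H(q))$ with $V(q,r,\alpha)$ via $\phi$. Let $P_1,\dots,P_k$ be internally vertex-disjoint paths from $u$ to $v$ in $\mathcal{H}_q^r$. Then there exist internally vertex-disjoint paths $Q_1,\dots,Q_k$ from $u$ to $v$ in the graph $H(q)$ such that each $Q_i$, $i\in[k]$, uses only vertices and edges of those standard copies of $H$ that correspond to edges of $P_i$.
   Context: For a graph $F$, an independent set $I\subseteq V(F)$ and a positive integer $q$, the $q$-book $F_I^q$ is obtained by taking $q$ vertex-disjoint copies of $F$ and identifying, for each $x\in I$, the $q$ copies of $x$. Let $V(H)=\{v_1,\dots,v_r\}$; define typed graphs $H_0=H$ (vertex $v_j$ of type $v_j$) and $H_i=(H_{i-1})^q_{U_i}$ for $1\le i\le r$, where $U_i$ is the set of vertices of type $v_i$ in $H_{i-1}$ and copies inherit types; the $q$-bookpile is $H(q)=H_r$. Standard copies: $H_0$ itself is the one standard copy in $H_0$; the standard copies in $H_i$ are the images of the standard copies in $H_{i-1}$ within each of the $q$ copies of $H_{i-1}$ forming $H_i$. $[q]=\{1,\dots,q\}$, $\alpha\notin[q]$ a symbol; $V(q,r,\alpha)$ is the set of $r$-tuples with exactly one entry $\alpha$ and others in $[q]$; $\mathcal{H}_q^r$ is the $r$-uniform hypergraph on $V(q,r,\alpha)$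 whose edges are indexed by $e\in[q]^r$, the edge $e$ consisting of the $r$ tuples obtained from $e$ by replacing exactly one entry by $\alpha$. (Such an isomorphism $\phi$ exists.) A hypergraph path from $u$ to $v$ is an alternating sequence $v_0e_1v_1\cdots e_\ell v_\ell$ with $v_0=u$, $v_\ell=v$, $\{v_i,v_{i+1}\}\subseteq e_{i+1}$ and non-consecutive edges disjoint; two such paths $ue_1\cdots e_\ell v$ and $ue_1'\cdots e_t'v$ are internally vertex-disjoint if $e_1\cap e_1'=\{u\}$, $e_\ell\cap e_t'=\{v\}$, and all other pairs $e_i,e_j'$ are disjoint. Graph paths are internally vertex-disjoint in the usual sense. -}

module Defs where

open import Data.Nat using (ℕ; zero; suc; _+_; _<_; _≤_)
open import Data.Fin using (Fin; zero; suc; toℕ; inject₁; fromℕ; _≟_)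
open import Data.Bool using (Bool; true; false; T)
open import Data.Maybe using (Maybe; just; nothing)
open import Data.Vec using (Vec; lookup; _[_]≔_)
import Data.Vec as Vec
open import Data.List using (List; foldl; allFin)
open import Data.Product using (Σ; _×_; _,_; ∃)
open import Data.Sum using (_⊎_)
open import Data.Unit using (⊤; tt)
open import Data.Empty using (⊥)
open import Relation.Nullary using (¬_; does)
open import Relation.Binary.PropositionalEquality using (_≡_; _≢_)

-- Simple graphs on the vertex set Fin r (vertex v_j is represented by j)

record Graph (r : ℕ) : Set where
  field
    E     : Fin r → Fin r → Bool
    sym   : ∀ a b → E a b ≡ E b a
    irrfl : ∀ a → E a a ≡ false
open Graph public

record Walk {r : ℕ} (H : Graph r) (a b : Fin r) : Set where
  field
    len   : ℕ
    vs    : Fin (suc len) → Fin r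
    start : vs zero ≡ a
    end   : vs (fromℕ len) ≡ b
    step  : ∀ (i : Fin len) → T (E H (vs (inject₁ i)) (vs (suc i)))

Connected : {r : ℕ} → Graph r → Set
Connected {r} H = ∀ (a b : Fin r) → Walk H a b

-- V : vertices, ty : type of a vertex (a vertex of H), Adj : adjacency,
-- Idx : index set of the standard copies, emb s : the standard copy s,
-- given as the map sending v_j to the vertex of type v_j of that copy.

record TGraph (r : ℕ) : Set₁ where
  field
    V   : Set
    ty  : V → Fin r
    Adj : V → V → Set
    Idx : Set
    emb : Idx → Fin r → V
open TGraph public

H₀ : {r : ℕ} → Graph r → TGraph r
H₀ {r} H = record
  { V = Fin r ; ty = λ j → j ; Adj = λ a b → T (E H a b)
  ; Idx = ⊤ ; emb = λ _ j → j }

module Book (r q : ℕ) (i : Fin r) (G : TGraph r) where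
  -- In the q-book G^q_U with U = vertices of type i, a vertex v of type i
  -- exists once (slot ⊤), any other vertex v exists in q copies (slot Fin q).
  SlotB : Bool → Set
  SlotB true  = ⊤
  SlotB false = Fin q

  shared : V G → Bool
  shared v = does (ty G v ≟ i)

  BV : Set
  BV = Σ (V G) (λ v → SlotB (shared v))

  liftB : (b : Bool) → Fin q → SlotB b
  liftB true  c = tt
  liftB false c = c

  lift : Fin q → V G → BV
  lift c v = v , liftB (shared v) c

  InCopyB : (b : Bool) → SlotB b → Fin q → Set
  InCopyB true  _ c = ⊤
  InCopyB false s c = s ≡ c

  InCopy : Fin q → BV → Set
  InCopy c (v , s) = InCopyB (shared v) s c

  book : TGraph r
  book = record
    { V   = BV
    ; ty  = λ x → ty G (Data.Product.proj₁ x)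
    ; Adj = λ x y → Adj G (Data.Product.proj₁ x) (Data.Product.proj₁ y)
                    × Σ (Fin q) (λ c → InCopy c x × InCopy c y)
    ; Idx = Idx G × Fin q
    ; emb = λ { (s , c) j → lift c (emb G s j) } }

-- H_i = (H_{i-1})^q_{U_i}, U_i the vertices of type v_i; H(q) = H_r
bookpile : {r : ℕ} → Graph r → ℕ → TGraph r
bookpile {r} H q = foldl (λ G i → Book.book r q i G) (H₀ H) (allFin r)

-- The hypergraph 𝓗_q^r on V(q,r,α); α is represented by nothing.

Tuple : ℕ → ℕ → Set
Tuple q r = Vec (Maybe (Fin q)) r

IsVQ : {q r : ℕ} → Tuple q r → Set
IsVQ {q} {r} t = Σ (Fin r) (λ j → (lookup t j ≡ nothing)
                   × (∀ k → lookup t k ≡ nothing → k ≡ j))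

_∈ₑ_ : {q r : ℕ} → Tuple q r → Vec (Fin q) r → Set
_∈ₑ_ {q} {r} t e = Σ (Fin r) (λ j → t ≡ (Vec.map just e [ j ]≔ nothing))

-- hypergraph paths v₀ e₁ v₁ ⋯ e_ℓ v_ℓ in 𝓗_q^r, ℓ = suc m ≥ 1
record HPath (q r : ℕ) (u v : Tuple q r) : Set where
  field
    m     : ℕ
    verts : Fin (suc (suc m)) → Tuple q r
    edges : Fin (suc m) → Vec (Fin q) r
    start : verts zero ≡ u
    end   : verts (fromℕ (suc m)) ≡ v
    inl   : ∀ i → verts (inject₁ i) ∈ₑ edges i
    inr   : ∀ i → verts (suc i) ∈ₑ edges i
    nonconsec : ∀ (i j : Fin (suc m)) → suc (toℕ i) < toℕ j →
                ∀ t → t ∈ₑ edges i → t ∈ₑ edges j → ⊥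
open HPath public

firstE : ∀ {q r u v} → HPath q r u v → Vec (Fin q) r
firstE P = edges P zero

lastE : ∀ {q r u v} → HPath q r u v → Vec (Fin q) r
lastE P = edges P (fromℕ (m P))

HIntDisjoint : ∀ {q r u v} → HPath q r u v → HPath q r u v → Set
HIntDisjoint {q} {r} {u} {v} P P' =
    (∀ t → t ∈ₑ firstE P → t ∈ₑ firstE P' → t ≡ u)
  × (∀ t → t ∈ₑ lastE P → t ∈ₑ lastE P' → t ≡ v)
  × (∀ (i : Fin (suc (m P))) (j : Fin (suc (m P'))) →
       ¬ (toℕ i ≡ 0 × toℕ j ≡ 0) →
       ¬ (toℕ i ≡ m P × toℕ j ≡ m P') →
       ∀ t → t ∈ₑ edges P i → t ∈ₑ edges P' j → ⊥)

record GPath {r : ℕ} (G : TGraph r) (x y : V G) : Set where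
  field
    len   : ℕ
    vs    : Fin (suc len) → V G
    start : vs zero ≡ x
    end   : vs (fromℕ len) ≡ y
    inj   : ∀ i j → vs i ≡ vs j → i ≡ j
    step  : ∀ (i : Fin len) → Adj G (vs (inject₁ i)) (vs (suc i))
open GPath public

GIntDisjoint : ∀ {r} {G : TGraph r} {x y} → GPath G x y → GPath G x y → Set
GIntDisjoint {x = x} {y} Q Q' =
  ∀ i j → vs Q i ≡ vs Q' j → (vs Q i ≡ x) ⊎ (vs Q i ≡ y)

CopyIs : ∀ {r q} {G : TGraph r} → (V G → Tuple q r) → Idx G → Vec (Fin q) r → Set
CopyIs {r} {q} {G} φ s e =
  ∀ (t : Tuple q r) → ((Σ (Fin r) λ a → φ (emb G s a) ≡ t) → t ∈ₑ e)
                    × (t ∈ₑ e → Σ (Fin r) λ a → φ (emb G s a) ≡ t)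

record IsIso {r q} (G : TGraph r) (φ : V G → Tuple q r) : Set where
  field
    into   : ∀ x → IsVQ (φ x)
    inj    : ∀ x y → φ x ≡ φ y → x ≡ y
    surj   : ∀ t → IsVQ t → Σ (V G) λ x → φ x ≡ t
    edgeTo   : ∀ (s : Idx G) → Σ (Vec (Fin q) r) λ e → CopyIs {G = G} φ s e
    edgeFrom : ∀ (e : Vec (Fin q) r) → Σ (Idx G) λ s → CopyIs {G = G} φ s e

CopyOfP : ∀ {r q u v} {G : TGraph r} → (V G → Tuple q r) → HPath q r u v → Idx G → Set
CopyOfP {G = G} φ P s = Σ (Fin (suc (m P))) λ j → CopyIs {G = G} φ s (edges P j)

UsesOnly : ∀ {r q u v} (H : Graph r) {x y} →
           (φ : V (bookpile H q) → Tuple q r) →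
           HPath q r u v → GPath (bookpile H q) x y → Set
UsesOnly {r} {q} H φ P Q =
    (∀ (i : Fin (suc (len Q))) → Σ (Idx G) λ s → CopyOfP {G = G} φ P s
        × Σ (Fin r) λ a → emb G s a ≡ vs Q i)
  × (∀ (i : Fin (len Q)) → Σ (Idx G) λ s → CopyOfP {G = G} φ P s
        × Σ (Fin r) λ a → Σ (Fin r) λ b → T (E H a b)
          × (emb G s a ≡ vs Q (inject₁ i)) × (emb G s b ≡ vs Q (suc i)))
  where G = bookpile H q

{-# OPTIONS --safe #-}
module Submission where

-- Each edge e of a hypergraph path P is the vertex set of a standard copy of
-- H, and consecutive edges meet in the vertex of P between them. Since H is
-- connected, walking inside each of these copies and concatenating gives a
-- walk in H(q) from u to v; erasing its loops gives a path Q. Every vertex of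
-- Q lies in an edge of P, so a vertex common to Q_i and Q_j lies in an edge of
-- P_i and in an edge of P_j; internal disjointness of the hypergraph paths
-- forces it to be u or v.

open import Defs
open import Data.Nat using (ℕ; _≤_; zero; suc)
import Data.Nat as ℕ
open import Data.Fin using (Fin; zero; suc; toℕ; inject₁; fromℕ)
import Data.Fin as Fin
open import Data.Fin.Properties using (toℕ-injective; toℕ-fromℕ)
open import Data.Product using (Σ; _×_; _,_; proj₁; proj₂)
open import Data.Sum using (_⊎_; inj₁; inj₂)
open import Data.Unit using (⊤; tt)
open import Data.Empty using (⊥-elim)
open import Data.Bool using (Bool; true; false; T)
open import Data.List using (List; []; _∷_; foldl; allFin)
import Data.Vec.Properties as Vec
import Data.Maybe.Properties as Maybe
open import Relation.Nullary using (Dec; yes; no; ¬_)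
open import Relation.Nullary.Decidable using (map′; _×-dec_)
open import Relation.Binary.Definitions using (DecidableEquality)
open import Relation.Binary.PropositionalEquality
  using (_≡_; _≢_; refl; trans; cong; subst; subst₂)
  renaming (sym to ≡-sym)

module Routes {A : Set} (_≟_ : DecidableEquality A)
               (Good : A → Set) (Step : A → A → Set)
               (source-good : ∀ {x z} → Step x z → Good x) where

  infixr 5 _∷_ _++_
  infix 4 _∈_ _∈?_

  data Route : A → A → Set where
    [_] : ∀ {x} → Good x → Route x x
    _∷_ : ∀ {x z y} → Step x z → Route z y → Route x y

  _++_ : ∀ {x z y} → Route x z → Route z y → Route x y
  [ _ ]    ++ ρ′ = ρ′
  (s ∷ ρ) ++ ρ′ = s ∷ (ρ ++ ρ′)

  concat : (n : ℕ) (a b : Fin (suc n) → A) → (∀ i → Route (a i) (b i)) →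
           (∀ (i : Fin n) → b (inject₁ i) ≡ a (suc i)) → Route (a zero) (b (fromℕ n))
  concat zero    a b ρ glue = ρ zero
  concat (suc n) a b ρ glue =
    ρ zero ++ subst (λ z → Route z (b (fromℕ (suc n)))) (≡-sym (glue zero))
                (concat n (λ i → a (suc i)) (λ i → b (suc i)) (λ i → ρ (suc i)) (λ i → glue (suc i)))

  _∈_ : A → ∀ {x y} → Route x y → Set
  w ∈ [_] {x} _   = w ≡ x
  w ∈ _∷_ {x} _ ρ = (w ≡ x) ⊎ (w ∈ ρ)

  _∈?_ : ∀ w {x y} (ρ : Route x y) → Dec (w ∈ ρ)
  w ∈? [_] {x} _ = w ≟ x
  w ∈? _∷_ {x} _ ρ with w ≟ x | w ∈? ρ
  ... | yes w≡x | _       = yes (inj₁ w≡x)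
  ... | no _    | yes w∈ρ = yes (inj₂ w∈ρ)
  ... | no w≢x  | no w∉ρ  = no λ { (inj₁ w≡x) → w≢x w≡x ; (inj₂ w∈ρ) → w∉ρ w∈ρ }

  Distinct : ∀ {x y} → Route x y → Set
  Distinct [ _ ]           = ⊤
  Distinct (_∷_ {x} _ ρ) = ¬ (x ∈ ρ) × Distinct ρ

  suffixFrom : ∀ {x z y} (ρ : Route z y) → x ∈ ρ → Distinct ρ → Σ (Route x y) Distinct
  suffixFrom [ g ]   refl         _          = [ g ] , tt
  suffixFrom (s ∷ ρ) (inj₁ refl)  distinct   = s ∷ ρ , distinct
  suffixFrom (s ∷ ρ) (inj₂ x∈ρ)   (_ , distinct) = suffixFrom ρ x∈ρ distinct

  loopErase : ∀ {x y} → Route x y → Σ (Route x y) Distinct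
  loopErase [ g ] = [ g ] , tt
  loopErase {x} (s ∷ ρ) with loopErase ρ
  ... | ρ′ , distinct with x ∈? ρ′
  ... | yes x∈ρ′ = suffixFrom ρ′ x∈ρ′ distinct
  ... | no x∉ρ′  = s ∷ ρ′ , x∉ρ′ , distinct

  length : ∀ {x y} → Route x y → ℕ
  length [ _ ]   = 0
  length (_ ∷ ρ) = suc (length ρ)

  vertex : ∀ {x y} (ρ : Route x y) → Fin (suc (length ρ)) → A
  vertex ([_] {x} _)   zero    = x
  vertex (_∷_ {x} _ ρ) zero    = x
  vertex (_ ∷ ρ)       (suc i) = vertex ρ i

  vertex-first : ∀ {x y} (ρ : Route x y) → vertex ρ zero ≡ x
  vertex-first [ _ ]   = refl
  vertex-first (_ ∷ _) = refl

  vertex-last : ∀ {x y} (ρ : Route x y) → vertex ρ (fromℕ (length ρ)) ≡ y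
  vertex-last [ _ ]   = refl
  vertex-last (_ ∷ ρ) = vertex-last ρ

  vertex-good : ∀ {x y} (ρ : Route x y) i → Good (vertex ρ i)
  vertex-good [ g ]   zero    = g
  vertex-good (s ∷ _) zero    = source-good s
  vertex-good (_ ∷ ρ) (suc i) = vertex-good ρ i

  vertex-step : ∀ {x y} (ρ : Route x y) (i : Fin (length ρ)) →
                Step (vertex ρ (inject₁ i)) (vertex ρ (suc i))
  vertex-step (_∷_ {x} s ρ) zero    = subst (Step x) (≡-sym (vertex-first ρ)) s
  vertex-step (_ ∷ ρ)       (suc i) = vertex-step ρ i

  vertex-∈ : ∀ {x y} (ρ : Route x y) i → vertex ρ i ∈ ρ
  vertex-∈ [ _ ]   zero    = refl
  vertex-∈ (_ ∷ _) zero    = inj₁ refl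
  vertex-∈ (_ ∷ ρ) (suc i) = inj₂ (vertex-∈ ρ i)

  vertex-injective : ∀ {x y} (ρ : Route x y) → Distinct ρ →
                     ∀ i j → vertex ρ i ≡ vertex ρ j → i ≡ j
  vertex-injective [ _ ]   _          zero    zero    _  = refl
  vertex-injective (_ ∷ _) _          zero    zero    _  = refl
  vertex-injective (_ ∷ ρ) (x∉ρ , _) zero    (suc j) eq =
    ⊥-elim (x∉ρ (subst (_∈ ρ) (≡-sym eq) (vertex-∈ ρ j)))
  vertex-injective (_ ∷ ρ) (x∉ρ , _) (suc i) zero    eq =
    ⊥-elim (x∉ρ (subst (_∈ ρ) eq (vertex-∈ ρ i)))
  vertex-injective (_ ∷ ρ) (_ , distinct) (suc i) (suc j) eq =
    cong suc (vertex-injective ρ distinct i j eq)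

CopiesAreSubgraphs : ∀ {r} → Graph r → TGraph r → Set
CopiesAreSubgraphs H K = ∀ s a b → T (E H a b) → Adj K (emb K s a) (emb K s b)

module _ {r : ℕ} (q : ℕ) (i : Fin r) (K : TGraph r) where
  open Book r q i K

  lift-inCopy : ∀ b (c : Fin q) → InCopyB b (liftB b c) c
  lift-inCopy true  c = tt
  lift-inCopy false c = refl

  book-copiesAreSubgraphs : ∀ (H : Graph r) → CopiesAreSubgraphs H K →
                            CopiesAreSubgraphs H book
  book-copiesAreSubgraphs H sub (s , c) a b ab =
    sub s a b ab , c , lift-inCopy (shared (emb K s a)) c , lift-inCopy (shared (emb K s b)) c

bookpile-copiesAreSubgraphs : ∀ {r} (H : Graph r) q → CopiesAreSubgraphs H (bookpile H q)
bookpile-copiesAreSubgraphs {r} H q = pile (allFin r) (H₀ H) (λ _ _ _ ab → ab)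
  where
    pile : ∀ (is : List (Fin r)) K → CopiesAreSubgraphs H K →
           CopiesAreSubgraphs H (foldl (λ K′ i → Book.book r q i K′) K is)
    pile []       K sub = sub
    pile (i ∷ is) K sub = pile is (Book.book r q i K) (book-copiesAreSubgraphs q i K H sub)

HIntDisjoint⇒endpoint : ∀ {q r u v} (P P′ : HPath q r u v) → HIntDisjoint P P′ →
                        ∀ {t} i j → t ∈ₑ edges P i → t ∈ₑ edges P′ j → (t ≡ u) ⊎ (t ≡ v)
HIntDisjoint⇒endpoint P P′ (first , last , middle) {t} i j t∈Pᵢ t∈P′ⱼ
  with (toℕ i ℕ.≟ 0) ×-dec (toℕ j ℕ.≟ 0)
... | yes (i≡0 , j≡0) =
  inj₁ (first t (subst (λ k → t ∈ₑ edges P k) (toℕ-injective i≡0) t∈Pᵢ)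
                (subst (λ k → t ∈ₑ edges P′ k) (toℕ-injective j≡0) t∈P′ⱼ))
... | no not-first with (toℕ i ℕ.≟ m P) ×-dec (toℕ j ℕ.≟ m P′)
...   | yes (i≡m , j≡m) =
  inj₂ (last t (subst (λ k → t ∈ₑ edges P k) (toℕ-injective (trans i≡m (≡-sym (toℕ-fromℕ (m P))))) t∈Pᵢ)
               (subst (λ k → t ∈ₑ edges P′ k) (toℕ-injective (trans j≡m (≡-sym (toℕ-fromℕ (m P′))))) t∈P′ⱼ))
...   | no not-last = ⊥-elim (middle i j not-first not-last t t∈Pᵢ t∈P′ⱼ)

module Bookpile {r : ℕ} (H : Graph r) {q : ℕ}
                (φ : V (bookpile H q) → Tuple q r) (iso : IsIso (bookpile H q) φ) where

  G : TGraph r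
  G = bookpile H q

  φ-injective : ∀ {x y} → φ x ≡ φ y → x ≡ y
  φ-injective = IsIso.inj iso _ _

  _≟V_ : DecidableEquality (V G)
  x ≟V y = map′ φ-injective (cong φ) (Vec.≡-dec (Maybe.≡-dec Fin._≟_) (φ x) (φ y))

  module AlongPath {u v : Tuple q r} (P : HPath q r u v) where

    InCopyOf : V G → Set
    InCopyOf w = Σ (Idx G) λ s → CopyOfP {G = G} φ P s × Σ (Fin r) λ a → emb G s a ≡ w

    EdgeInCopyOf : V G → V G → Set
    EdgeInCopyOf x z = Σ (Idx G) λ s → CopyOfP {G = G} φ P s
                       × Σ (Fin r) λ a → Σ (Fin r) λ b → T (E H a b)
                         × (emb G s a ≡ x) × (emb G s b ≡ z)

    source-inCopy : ∀ {x z} → EdgeInCopyOf x z → InCopyOf x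
    source-inCopy (s , c , a , _ , _ , x≡ , _) = s , c , a , x≡

    open Routes _≟V_ InCopyOf EdgeInCopyOf source-inCopy public

    inCopyOf-edge : ∀ {w} → InCopyOf w → Σ (Fin (suc (m P))) λ j → φ w ∈ₑ edges P j
    inCopyOf-edge {w} (s , (j , copy) , a , eq) = j , proj₁ (copy (φ w)) (a , cong φ eq)

    copyRoute : ∀ s → CopyOfP {G = G} φ P s → ∀ {a b} → Walk H a b → Route (emb G s a) (emb G s b)
    copyRoute s c w = subst₂ Route (cong (emb G s) (Walk.start w)) (cong (emb G s) (Walk.end w))
                        (along (Walk.len w) (Walk.vs w) (Walk.step w))
      where
        along : ∀ n (f : Fin (suc n) → Fin r) → (∀ (i : Fin n) → T (E H (f (inject₁ i)) (f (suc i)))) →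
                Route (emb G s (f zero)) (emb G s (f (fromℕ n)))
        along zero    f _    = [ s , c , f zero , refl ]
        along (suc n) f step =
          (s , c , f zero , f (suc zero) , step zero , refl , refl)
          ∷ along n (λ i → f (suc i)) (λ i → step (suc i))

    module _ (i : Fin (suc (m P))) where
      private
        chosen = IsIso.edgeFrom iso (edges P i)
        entryTuple = proj₂ chosen (verts P (inject₁ i))
        exitTuple  = proj₂ chosen (verts P (suc i))

      copyAt : Idx G
      copyAt = proj₁ chosen

      copyAt-isEdge : CopyIs {G = G} φ copyAt (edges P i)
      copyAt-isEdge = proj₂ chosen

      entry exit : Fin r
      entry = proj₁ (proj₂ entryTuple (inl P i))
      exit  = proj₁ (proj₂ exitTuple (inr P i))

      φ-entry : φ (emb G copyAt entry) ≡ verts P (inject₁ i)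
      φ-entry = proj₂ (proj₂ entryTuple (inl P i))

      φ-exit : φ (emb G copyAt exit) ≡ verts P (suc i)
      φ-exit = proj₂ (proj₂ exitTuple (inr P i))

    route : Connected H → ∀ {x y} → φ x ≡ u → φ y ≡ v → Route x y
    route conn φx≡u φy≡v =
      subst₂ Route first-is-x last-is-y (concat (m P) enter leave segment glue)
      where
        enter leave : Fin (suc (m P)) → V G
        enter i = emb G (copyAt i) (entry i)
        leave i = emb G (copyAt i) (exit i)
        segment : ∀ i → Route (enter i) (leave i)
        segment i = copyRoute (copyAt i) (i , copyAt-isEdge i) (conn (entry i) (exit i))
        glue : ∀ (i : Fin (m P)) → leave (inject₁ i) ≡ enter (suc i)
        glue i = φ-injective (trans (φ-exit (inject₁ i)) (≡-sym (φ-entry (suc i))))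
        first-is-x = φ-injective (trans (φ-entry zero) (trans (HPath.start P) (≡-sym φx≡u)))
        last-is-y  = φ-injective (trans (φ-exit (fromℕ (m P))) (trans (HPath.end P) (≡-sym φy≡v)))

    toGPath : ∀ {x y} (ρ : Route x y) → Distinct ρ → GPath G x y
    toGPath ρ distinct = record
      { len = length ρ ; vs = vertex ρ ; start = vertex-first ρ ; end = vertex-last ρ
      ; inj = vertex-injective ρ distinct
      ; step = λ i → adjacent (vertex-step ρ i) }
      where
        adjacent : ∀ {x z} → EdgeInCopyOf x z → Adj G x z
        adjacent (s , _ , a , b , ab , x≡ , z≡) =
          subst₂ (Adj G) x≡ z≡ (bookpile-copiesAreSubgraphs H q s a b ab)

    toGPath-usesOnly : ∀ {x y} (ρ : Route x y) (distinct : Distinct ρ) →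
                       UsesOnly H φ P (toGPath ρ distinct)
    toGPath-usesOnly ρ _ = vertex-good ρ , vertex-step ρ

    path : Connected H → ∀ {x y} → φ x ≡ u → φ y ≡ v →
           Σ (GPath G x y) (UsesOnly H φ P)
    path conn φx≡u φy≡v with loopErase (route conn φx≡u φy≡v)
    ... | ρ , distinct = toGPath ρ distinct , toGPath-usesOnly ρ distinct

  usesOnly-intDisjoint : ∀ {u v x y} → φ x ≡ u → φ y ≡ v →
    (P P′ : HPath q r u v) → HIntDisjoint P P′ →
    (Q Q′ : GPath G x y) → UsesOnly H φ P Q → UsesOnly H φ P′ Q′ → GIntDisjoint Q Q′
  usesOnly-intDisjoint φx≡u φy≡v P P′ disjoint Q Q′ (Q-in , _) (Q′-in , _) a b eq
    with AlongPath.inCopyOf-edge P (Q-in a) | AlongPath.inCopyOf-edge P′ (Q′-in b)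
  ... | i , φw∈Pᵢ | j , φw∈P′ⱼ
    with HIntDisjoint⇒endpoint P P′ disjoint i j φw∈Pᵢ
           (subst (λ w → φ w ∈ₑ edges P′ j) (≡-sym eq) φw∈P′ⱼ)
  ... | inj₁ φw≡u = inj₁ (φ-injective (trans φw≡u (≡-sym φx≡u)))
  ... | inj₂ φw≡v = inj₂ (φ-injective (trans φw≡v (≡-sym φy≡v)))

lemma7 : ∀ (r : ℕ) (H : Graph r) → Connected H → (q : ℕ) → 1 ≤ q →
         (φ : V (bookpile H q) → Tuple q r) → IsIso (bookpile H q) φ →
         (u v : Tuple q r) (k : ℕ) (P : Fin k → HPath q r u v) →
         (∀ i j → i ≢ j → HIntDisjoint (P i) (P j)) →
         (x y : V (bookpile H q)) → φ x ≡ u → φ y ≡ v →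
         Σ (Fin k → GPath (bookpile H q) x y) λ Q →
           (∀ i j → i ≢ j → GIntDisjoint (Q i) (Q j))
           × (∀ i → UsesOnly H φ (P i) (Q i))
lemma7 r H conn q _ φ iso u v k P P-disjoint x y φx≡u φy≡v =
  Q , (λ i j i≢j → usesOnly-intDisjoint φx≡u φy≡v (P i) (P j) (P-disjoint i j i≢j)
                     (Q i) (Q j) (Q-usesOnly i) (Q-usesOnly j))
    , Q-usesOnly
  where
    open Bookpile H φ iso
    Q : Fin k → GPath G x y
    Q i = proj₁ (AlongPath.path (P i) conn φx≡u φy≡v)
    Q-usesOnly : ∀ i → UsesOnly H φ (P i) (Q i)
    Q-usesOnly i = proj₂ (AlongPath.path (P i) conn φx≡u φy≡v)
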